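{- Let $s$ be a stack, let $\mathbb{H}$ be the set of all heaps, and let $u$ be the empty heap. Then $(\mathbb{H},\uplus^s,u)$ is a separation algebra, i.e., $\uplus^s$ is a partial binary operation on $\mathbb{H}$ that is commutative and associative, has unit $u$, and is cancellative: for all $h,h_1,h_2\in\mathbb{H}$, if $h\uplus^s h_1=h\uplus^s h_2\neq\bot$ then $h_1=h_2$.
   Context: $\mathrm{Loc}$ is an infinite set of locations and $\mathrm{Var}$ a set of variables. A stack is a partial function $s:\mathrm{Var}\rightharpoonup\mathrm{Loc}$; a heap is a finite partial function $h:\mathrm{Loc}\rightharpoonup\mathrm{Loc}$. Let $\mathrm{locs}(h)=\mathrm{dom}(h)\cup\mathrm{img}(h)$. For a stack $s$ and heaps $h_1,h_2$: $h_1\uplus^s h_2 := h_1\cup h_2$ if $\mathrm{dom}(h_1)\cap\mathrm{dom}(h_2)=\emptyset$ and $\mathrm{locs}(h_1)\cap\mathrm{locs}(h_2)\subseteq\mathrm{img}(s)$, and undefined ($\bot$) otherwise. -}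

module Defs where

open import Data.Maybe using (Maybe; just; nothing)
open import Data.List using (List; []; _++_)
open import Data.List.Membership.Propositional using (_∈_; _∉_)
open import Data.Product using (Σ; ∃; _×_; _,_)
open import Data.Empty using (⊥; ⊥-elim)
open import Data.Sum using (_⊎_)
open import Data.Maybe.Properties using (just-injective)
open import Relation.Nullary using (¬_)
open import Relation.Binary.PropositionalEquality using (_≡_; refl; sym; trans)
open import Function.Bundles using (_⇔_)

Infinite : Set → Set
Infinite A = (xs : List A) → Σ A (λ a → a ∉ xs)

Stack : Set → Set → Set
Stack Var Loc = Var → Maybe Loc

InImgS : {Var Loc : Set} → Stack Var Loc → Loc → Set
InImgS {Var} s l = Σ Var (λ v → s v ≡ just l)

record Heap (Loc : Set) : Set where
  constructor mkHeap
  field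
    fun    : Loc → Maybe Loc
    finite : Σ (List Loc) (λ xs → ∀ l → ¬ (fun l ≡ nothing) → l ∈ xs)
open Heap public

module _ {Loc : Set} where

  just≢nothing : ∀ {x : Loc} → just x ≡ nothing → ⊥
  just≢nothing ()

  _≈ₕ_ : Heap Loc → Heap Loc → Set
  h₁ ≈ₕ h₂ = ∀ l → fun h₁ l ≡ fun h₂ l

  InDom : Heap Loc → Loc → Set
  InDom h l = Σ Loc (λ l' → fun h l ≡ just l')

  InImg : Heap Loc → Loc → Set
  InImg h l = Σ Loc (λ l' → fun h l' ≡ just l)

  InLocs : Heap Loc → Loc → Set
  InLocs h l = InDom h l ⊎ InImg h l

  emptyHeap : Heap Loc
  emptyHeap = mkHeap (λ _ → nothing) ([] , λ l p → ⊥-elim (p refl))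

  -- set-theoretic union of heaps (left-biased; only used when domains are disjoint)
  _∪ₕ_ : Heap Loc → Heap Loc → Heap Loc
  h₁ ∪ₕ h₂ = mkHeap f fin
    where
      f : Loc → Maybe Loc
      f l with fun h₁ l
      ... | just x  = just x
      ... | nothing = fun h₂ l
      fin : Σ (List Loc) (λ xs → ∀ l → ¬ (f l ≡ nothing) → l ∈ xs)
      fin with finite h₁ | finite h₂
      ... | xs , p | ys , q = xs ++ ys , g
        where
          open import Data.List.Membership.Propositional.Properties using (∈-++⁺ˡ; ∈-++⁺ʳ)
          g : ∀ l → ¬ (f l ≡ nothing) → l ∈ xs ++ ys
          g l nn with fun h₁ l in eq
          ... | just x  = ∈-++⁺ˡ (p l λ e → just≢nothing (trans (sym eq) e))
          ... | nothing = ∈-++⁺ʳ xs (q l nn)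

  -- Definedness of h₁ ⊎ˢ h₂: dom(h₁) ∩ dom(h₂) = ∅ and locs(h₁) ∩ locs(h₂) ⊆ img(s).
  Compat : {Var : Set} → Stack Var Loc → Heap Loc → Heap Loc → Set
  Compat s h₁ h₂ =
    (∀ l → InDom h₁ l → InDom h₂ l → ⊥) ×
    (∀ l → InLocs h₁ l → InLocs h₂ l → InImgS s l)

-- A partial binary operation on a carrier A (with equality _≈_) is given by a
-- definedness relation D and the value _∙_ (meaningful where D holds).
-- Equalities between partial terms are Kleene equalities: one side is defined
-- iff the other is, and then the values agree.
record IsSeparationAlgebra {A : Set} (_≈_ : A → A → Set)
         (D : A → A → Set) (_∙_ : A → A → A) (u : A) : Set where
  field
    comm-def : ∀ x y → D x y ⇔ D y x
    comm     : ∀ x y → D x y → (x ∙ y) ≈ (y ∙ x)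
    assoc-def : ∀ x y z → (Σ (D x y) λ _ → D (x ∙ y) z) ⇔ (Σ (D y z) λ _ → D x (y ∙ z))
    assoc     : ∀ x y z → D x y → D (x ∙ y) z → D y z → D x (y ∙ z) →
                ((x ∙ y) ∙ z) ≈ (x ∙ (y ∙ z))
    unitʳ-def : ∀ x → D x u
    unitʳ     : ∀ x → (x ∙ u) ≈ x
    unitˡ-def : ∀ x → D u x
    unitˡ     : ∀ x → (u ∙ x) ≈ x
    cancel : ∀ x y z → D x y → D x z → (x ∙ y) ≈ (x ∙ z) → y ≈ z

module Submission where

-- A heap union a ∪ₕ b is, location by location, the left-biased choice
-- fun a l <∣> fun b l on partial values (Data.Maybe's _<∣>_).  The algebraic
-- laws of the separation algebra are therefore inherited pointwise from
-- _<∣>_: it is associative and has unit nothing outright, and it is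
-- commutative and left-cancellative on pairs of values that are never both
-- defined, which is exactly what disjointness of domains guarantees.
--
-- The definedness laws concern Compat s, which is a conjunction of two
-- instances of one shape, "Separated P Q a b": every location having
-- property P in both a and b satisfies Q (P = InDom, Q = ⊥ for disjointness;
-- P = InLocs, Q = InImgS s for the shared condition).  Associativity of
-- definedness in one direction follows from how dom and locs of a union
-- decompose; the other direction is reduced to it using symmetry of Compat,
-- commutativity of disjoint union, and invariance of Compat under heap
-- equality.

open import Defs
open import Data.Maybe using (Maybe; just; nothing; _<∣>_)
open import Data.Maybe.Properties using (<∣>-assoc; <∣>-identityʳ)
open import Data.Product using (_×_; _,_; proj₁)
open import Data.Empty using (⊥; ⊥-elim)
open import Data.Sum using (_⊎_; inj₁; inj₂; [_,_])
open import Relation.Nullary using (¬_)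
open import Relation.Binary.PropositionalEquality using (_≡_; refl; sym; trans; cong; module ≡-Reasoning)
open import Function.Bundles using (mk⇔)

Apart : {A : Set} → Maybe A → Maybe A → Set
Apart p q = ∀ {m n} → p ≡ just m → q ≡ just n → ⊥

<∣>-comm-apart : {A : Set} (p q : Maybe A) → Apart p q → (p <∣> q) ≡ (q <∣> p)
<∣>-comm-apart (just x) (just y) apart = ⊥-elim (apart refl refl)
<∣>-comm-apart (just x) nothing  apart = refl
<∣>-comm-apart nothing  q        apart = sym (<∣>-identityʳ q)

<∣>-cancelˡ-apart : {A : Set} (p q r : Maybe A) → Apart p q → Apart p r →
                    (p <∣> q) ≡ (p <∣> r) → q ≡ r
<∣>-cancelˡ-apart (just x) (just y) r        apq apr eq = ⊥-elim (apq refl refl)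
<∣>-cancelˡ-apart (just x) nothing  (just z) apq apr eq = ⊥-elim (apr refl refl)
<∣>-cancelˡ-apart (just x) nothing  nothing  apq apr eq = refl
<∣>-cancelˡ-apart nothing  q        r        apq apr eq = eq

<∣>-just : {A : Set} (p q : Maybe A) {m : A} → (p <∣> q) ≡ just m → p ≡ just m ⊎ q ≡ just m
<∣>-just (just x) q eq = inj₁ eq
<∣>-just nothing  q eq = inj₂ eq

<∣>-justˡ : {A : Set} (p q : Maybe A) {m : A} → p ≡ just m → (p <∣> q) ≡ just m
<∣>-justˡ (just x) q eq = eq

module _ {Loc : Set} where

  fun-∪ₕ : (a b : Heap Loc) (l : Loc) → fun (a ∪ₕ b) l ≡ (fun a l <∣> fun b l)
  fun-∪ₕ a b l with fun a l
  ... | just x  = refl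
  ... | nothing = refl

  Disjoint : Heap Loc → Heap Loc → Set
  Disjoint a b = ∀ l → InDom a l → InDom b l → ⊥

  Disjoint-sym : (a b : Heap Loc) → Disjoint a b → Disjoint b a
  Disjoint-sym a b disj l p q = disj l q p

  disjoint⇒apart : (a b : Heap Loc) → Disjoint a b → ∀ l → Apart (fun a l) (fun b l)
  disjoint⇒apart a b disj l ea eb = disj l (_ , ea) (_ , eb)

  ∪ₕ-comm : (a b : Heap Loc) → Disjoint a b → (a ∪ₕ b) ≈ₕ (b ∪ₕ a)
  ∪ₕ-comm a b disj l =
    trans (fun-∪ₕ a b l)
          (trans (<∣>-comm-apart (fun a l) (fun b l) (disjoint⇒apart a b disj l))
                 (sym (fun-∪ₕ b a l)))

  ∪ₕ-assoc : (a b c : Heap Loc) → ((a ∪ₕ b) ∪ₕ c) ≈ₕ (a ∪ₕ (b ∪ₕ c))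
  ∪ₕ-assoc a b c l = begin
    fun ((a ∪ₕ b) ∪ₕ c) l                ≡⟨ fun-∪ₕ (a ∪ₕ b) c l ⟩
    fun (a ∪ₕ b) l <∣> fun c l           ≡⟨ cong (_<∣> fun c l) (fun-∪ₕ a b l) ⟩
    (fun a l <∣> fun b l) <∣> fun c l    ≡⟨ <∣>-assoc (fun a l) (fun b l) (fun c l) ⟩
    fun a l <∣> (fun b l <∣> fun c l)    ≡⟨ cong (fun a l <∣>_) (fun-∪ₕ b c l) ⟨
    fun a l <∣> fun (b ∪ₕ c) l           ≡⟨ fun-∪ₕ a (b ∪ₕ c) l ⟨
    fun (a ∪ₕ (b ∪ₕ c)) l                ∎
    where open ≡-Reasoning

  ∪ₕ-identityʳ : (a : Heap Loc) → (a ∪ₕ emptyHeap) ≈ₕ a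
  ∪ₕ-identityʳ a l = trans (fun-∪ₕ a emptyHeap l) (<∣>-identityʳ (fun a l))

  ∪ₕ-identityˡ : (a : Heap Loc) → (emptyHeap ∪ₕ a) ≈ₕ a
  ∪ₕ-identityˡ a l = refl

  ∪ₕ-cancelˡ : (a b c : Heap Loc) → Disjoint a b → Disjoint a c →
               (a ∪ₕ b) ≈ₕ (a ∪ₕ c) → b ≈ₕ c
  ∪ₕ-cancelˡ a b c dab dac eq l =
    <∣>-cancelˡ-apart (fun a l) (fun b l) (fun c l)
      (disjoint⇒apart a b dab l) (disjoint⇒apart a c dac l)
      (trans (sym (fun-∪ₕ a b l)) (trans (eq l) (fun-∪ₕ a c l)))

  InDom-resp : (a a' : Heap Loc) → a ≈ₕ a' → ∀ {l} → InDom a l → InDom a' l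
  InDom-resp a a' eq {l} (m , e) = m , trans (sym (eq l)) e

  InImg-resp : (a a' : Heap Loc) → a ≈ₕ a' → ∀ {l} → InImg a l → InImg a' l
  InImg-resp a a' eq (l' , e) = l' , trans (sym (eq l')) e

  InLocs-resp : (a a' : Heap Loc) → a ≈ₕ a' → ∀ {l} → InLocs a l → InLocs a' l
  InLocs-resp a a' eq (inj₁ d) = inj₁ (InDom-resp a a' eq d)
  InLocs-resp a a' eq (inj₂ i) = inj₂ (InImg-resp a a' eq i)

  dom-∪ₕ⁻ : (a b : Heap Loc) → ∀ l → InDom (a ∪ₕ b) l → InDom a l ⊎ InDom b l
  dom-∪ₕ⁻ a b l (m , e) with <∣>-just (fun a l) (fun b l) (trans (sym (fun-∪ₕ a b l)) e)
  ... | inj₁ ea = inj₁ (m , ea)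
  ... | inj₂ eb = inj₂ (m , eb)

  img-∪ₕ⁻ : (a b : Heap Loc) → ∀ l → InImg (a ∪ₕ b) l → InImg a l ⊎ InImg b l
  img-∪ₕ⁻ a b l (l' , e) with <∣>-just (fun a l') (fun b l') (trans (sym (fun-∪ₕ a b l')) e)
  ... | inj₁ ea = inj₁ (l' , ea)
  ... | inj₂ eb = inj₂ (l' , eb)

  locs-∪ₕ⁻ : (a b : Heap Loc) → ∀ l → InLocs (a ∪ₕ b) l → InLocs a l ⊎ InLocs b l
  locs-∪ₕ⁻ a b l (inj₁ d) = [ (λ da → inj₁ (inj₁ da)) , (λ db → inj₂ (inj₁ db)) ] (dom-∪ₕ⁻ a b l d)
  locs-∪ₕ⁻ a b l (inj₂ i) = [ (λ ia → inj₁ (inj₂ ia)) , (λ ib → inj₂ (inj₂ ib)) ] (img-∪ₕ⁻ a b l i)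

  dom-∪ₕˡ : (a b : Heap Loc) → ∀ l → InDom a l → InDom (a ∪ₕ b) l
  dom-∪ₕˡ a b l (m , e) = m , trans (fun-∪ₕ a b l) (<∣>-justˡ (fun a l) (fun b l) e)

  locs-∪ₕˡ : (a b : Heap Loc) → ∀ l → InLocs a l → InLocs (a ∪ₕ b) l
  locs-∪ₕˡ a b l (inj₁ d)        = inj₁ (dom-∪ₕˡ a b l d)
  locs-∪ₕˡ a b l (inj₂ (l' , e)) =
    inj₂ (l' , trans (fun-∪ₕ a b l') (<∣>-justˡ (fun a l') (fun b l') e))

  dom-∪ₕʳ : (a b : Heap Loc) → Disjoint a b → ∀ l → InDom b l → InDom (a ∪ₕ b) l
  dom-∪ₕʳ a b disj l d = InDom-resp (b ∪ₕ a) (a ∪ₕ b) (∪ₕ-comm b a (Disjoint-sym a b disj)) (dom-∪ₕˡ b a l d)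

  locs-∪ₕʳ : (a b : Heap Loc) → Disjoint a b → ∀ l → InLocs b l → InLocs (a ∪ₕ b) l
  locs-∪ₕʳ a b disj l x = InLocs-resp (b ∪ₕ a) (a ∪ₕ b) (∪ₕ-comm b a (Disjoint-sym a b disj)) (locs-∪ₕˡ b a l x)

  locs-empty : {l : Loc} → ¬ InLocs (emptyHeap {Loc}) l
  locs-empty (inj₁ (_ , ()))
  locs-empty (inj₂ (_ , ()))

  Separated : (Heap Loc → Loc → Set) → (Loc → Set) → Heap Loc → Heap Loc → Set
  Separated P Q a b = ∀ l → P a l → P b l → Q l

  Separated-assoc : {P : Heap Loc → Loc → Set} {Q : Loc → Set} (x y z : Heap Loc) →
                    (∀ l → P (y ∪ₕ z) l → P y l ⊎ P z l) →
                    (∀ l → P x l → P (x ∪ₕ y) l) →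
                    (∀ l → P y l → P (x ∪ₕ y) l) →
                    Separated P Q x y → Separated P Q (x ∪ₕ y) z →
                    Separated P Q y z × Separated P Q x (y ∪ₕ z)
  Separated-assoc x y z split incˡ incʳ sxy sxyz =
    (λ l py pz → sxyz l (incʳ l py) pz) ,
    (λ l px pyz → [ sxy l px , sxyz l (incˡ l px) ] (split l pyz))

module _ {Var Loc : Set} (s : Stack Var Loc) where

  Compat-sym : (a b : Heap Loc) → Compat s a b → Compat s b a
  Compat-sym a b (disj , shared) = Disjoint-sym a b disj , (λ l p q → shared l q p)

  Compat-respˡ : (a a' b : Heap Loc) → a ≈ₕ a' → Compat s a b → Compat s a' b
  Compat-respˡ a a' b eq (disj , shared) =
    (λ l p q → disj l (InDom-resp a' a (λ l' → sym (eq l')) p) q) ,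
    (λ l p q → shared l (InLocs-resp a' a (λ l' → sym (eq l')) p) q)

  Compat-respʳ : (a b b' : Heap Loc) → b ≈ₕ b' → Compat s a b → Compat s a b'
  Compat-respʳ a b b' eq c = Compat-sym b' a (Compat-respˡ b b' a eq (Compat-sym a b c))

  Compat-emptyʳ : (a : Heap Loc) → Compat s a (emptyHeap {Loc})
  Compat-emptyʳ a = (λ l p q → locs-empty {l = l} (inj₁ q)) , (λ l p q → ⊥-elim (locs-empty q))

  Compat-assocʳ : (x y z : Heap Loc) → Compat s x y → Compat s (x ∪ₕ y) z →
                  Compat s y z × Compat s x (y ∪ₕ z)
  Compat-assocʳ x y z (dxy , kxy) (dxyz , kxyz)
    with Separated-assoc x y z (dom-∪ₕ⁻ y z) (dom-∪ₕˡ x y) (dom-∪ₕʳ x y dxy) dxy dxyz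
       | Separated-assoc x y z (locs-∪ₕ⁻ y z) (locs-∪ₕˡ x y) (locs-∪ₕʳ x y dxy) kxy kxyz
  ... | dyz , dx-yz | kyz , kx-yz = (dyz , kyz) , (dx-yz , kx-yz)

  -- The converse, by applying Compat-assocʳ to z, y, x and commuting the
  -- (disjoint) unions back.
  Compat-assocˡ : (x y z : Heap Loc) → Compat s y z → Compat s x (y ∪ₕ z) →
                  Compat s x y × Compat s (x ∪ₕ y) z
  Compat-assocˡ x y z cyz cx-yz
    with Compat-assocʳ z y x (Compat-sym y z cyz)
           (Compat-respˡ (y ∪ₕ z) (z ∪ₕ y) x (∪ₕ-comm y z (proj₁ cyz)) (Compat-sym x (y ∪ₕ z) cx-yz))
  ... | cyx , cz-yx =
    Compat-sym y x cyx ,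
    Compat-sym z (x ∪ₕ y) (Compat-respʳ z (y ∪ₕ x) (x ∪ₕ y) (∪ₕ-comm y x (proj₁ cyx)) cz-yx)

mainTheorem3 : (Loc Var : Set) → Infinite Loc → (s : Stack Var Loc) →
               IsSeparationAlgebra (_≈ₕ_ {Loc}) (Compat s) _∪ₕ_ emptyHeap
mainTheorem3 Loc Var _ s = record
  { comm-def  = λ x y → mk⇔ (Compat-sym s x y) (Compat-sym s y x)
  ; comm      = λ x y c → ∪ₕ-comm x y (proj₁ c)
  ; assoc-def = λ x y z → mk⇔ (λ (cxy , c) → Compat-assocʳ s x y z cxy c)
                                (λ (cyz , c) → Compat-assocˡ s x y z cyz c)
  ; assoc     = λ x y z _ _ _ _ → ∪ₕ-assoc x y z
  ; unitʳ-def = Compat-emptyʳ s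
  ; unitʳ     = ∪ₕ-identityʳ
  ; unitˡ-def = λ x → Compat-sym s x emptyHeap (Compat-emptyʳ s x)
  ; unitˡ     = ∪ₕ-identityˡ
  ; cancel    = λ x y z cy cz → ∪ₕ-cancelˡ x y z (proj₁ cy) (proj₁ cz)
  }
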